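{- Fix $k\ge2$ and write $A_xy=A_x(k,y)$. If $m\equiv_k A_ab$ with $a>0$ and $(c_i)_{i\le a}$ is the left expansion sequence for $A_ab$, then $m-1\equiv^s_k c_a\cdot(k-1)+(c_a-1)$.
   Context: Ackermann function: for $k\ge 2$, $a,b\ge 0$: $A_a(k,-1):=1$, $A_0(k,b):=k^b$, $A_{a+1}(k,b):=A_a(k,\cdot)^k(A_{a+1}(k,b-1))$; $A_x^jy$ denotes the $j$-fold iterate of $y\mapsto A_xy$. $k$-normal form: for $m>0$, $m\equiv_k A_ab+c$ means $m=A_ab+c$ and there exist $n\ge1$ and naturals $a_1..a_n$, $b_1..b_n$, $m_0..m_n$ with $m_0=0$; for $0\le i<n$: $A_{a_{i+1}}m_i\le m<A_{a_{i+1}+1}m_i$, $A_{a_{i+1}}b_{i+1}\le m<A_{a_{i+1}}(b_{i+1}+1)$, $m_{i+1}=A_{a_{i+1}}b_{i+1}$; $A_0m_n>m$; $a=a_n$, $b=b_n$ (unique). $m\equiv_k A_ab$ means $m\equiv_k A_ab+0$. Extended $k$-normal form: $m\equiv^e_k A_ab\cdot p+q$ means $m\equiv_k A_ab+c$ for some $c$, $m=A_ab\cdot p+q$, and $0\le q<A_ab$. Simplified $k$-normal form: $m\equiv^s_k d\cdot p+q$ means there are $a,b$ with $d=A_ab$ and $m\equiv^e_k A_ab\cdot p+q$. Left expansion sequence: for $A_ab$ in normal form with $a>0$, define $c_0=A_a(b-1)$ (using $A_a(-1)=1$ if $b=0$) and $c_i=A_{a-i}\big(A_{a-i}^{k-1}c_{i-1}-1\big)$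 for $1\le i\le a$. -}

module Defs where

open import Data.Nat using (ℕ; zero; suc; _+_; _*_; _∸_; _^_; _≤_; _<_)
open import Data.Product using (Σ; _×_; ∃)
open import Relation.Binary.PropositionalEquality using (_≡_)

iter : ℕ → (ℕ → ℕ) → ℕ → ℕ
iter zero    f y = y
iter (suc j) f y = f (iter j f y)

-- Shifted Ackermann function: A′ a k n = A_a(k, n - 1), so that
-- A′ a k 0 = A_a(k,-1) = 1.
A′ : ℕ → ℕ → ℕ → ℕ
A′ a       k zero    = 1
A′ zero    k (suc b) = k ^ b
A′ (suc a) k (suc b) = iter k (λ y → A′ a k (suc y)) (A′ (suc a) k b)

A : ℕ → ℕ → ℕ → ℕ
A a k b = A′ a k (suc b)

-- k-normal form:  m ≡_k A_a b + c
NF : (k m a b c : ℕ) → Set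
NF k m a b c =
  0 < m × m ≡ A a k b + c ×
  Σ ℕ λ n → 1 ≤ n ×
  Σ (ℕ → ℕ) λ as → Σ (ℕ → ℕ) λ bs → Σ (ℕ → ℕ) λ ms →
    ms 0 ≡ 0 ×
    (∀ i → i < n →
        A (as (suc i)) k (ms i) ≤ m × m < A (suc (as (suc i))) k (ms i) ×
        A (as (suc i)) k (bs (suc i)) ≤ m × m < A (as (suc i)) k (suc (bs (suc i))) ×
        ms (suc i) ≡ A (as (suc i)) k (bs (suc i))) ×
    m < A 0 k (ms n) ×
    a ≡ as n × b ≡ bs n

-- extended k-normal form:  m ≡^e_k A_a b · p + q
ExtNF : (k m a b p q : ℕ) → Set
ExtNF k m a b p q =
  (∃ λ c → NF k m a b c) × m ≡ A a k b * p + q × q < A a k b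

-- simplified k-normal form:  m ≡^s_k d · p + q
SimpNF : (k m d p q : ℕ) → Set
SimpNF k m d p q = Σ ℕ λ a → Σ ℕ λ b → d ≡ A a k b × ExtNF k m a b p q

-- left expansion sequence for A_a b: leftSeq k a b i = c_i  (meaningful for i ≤ a)
-- c_0 = A_a(b-1) = A′ a k b  (equal to 1 when b = 0)
leftSeq : (k a b : ℕ) → ℕ → ℕ
leftSeq k a b zero    = A′ a k b
leftSeq k a b (suc i) =
  A (a ∸ suc i) k (iter (k ∸ 1) (A (a ∸ suc i) k) (leftSeq k a b i) ∸ 1)

module Submission where

-- Write m = A_a b = A_{a-1}^k c_0. The normal form of m - 1 keeps every step of
-- that of m except the last one, which it replaces by a descent: a step at level a
-- with index b - 1 (unless m_{n-1} = b), then one step at each level a-1, ..., 0,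
-- the step at level a-1-i having index A_{a-1-i}^{k-1} c_i - 1 and value c_{i+1}.
-- At level 0, A_0 (y + 1) = k · A_0 y gives m = k · c_a, so m - 1 = c_a (k-1) + (c_a - 1).

open import Defs
open import Data.Nat using (ℕ; zero; suc; _+_; _*_; _∸_; _≤_; _<_; z≤n; s≤s; s≤s⁻¹; _≟_)
open import Data.Nat.Properties
open import Data.Nat.Solver using (module +-*-Solver)
open import Data.Product using (Σ; _×_; _,_; proj₁; proj₂)
open import Data.Sum using (inj₁; inj₂)
open import Relation.Nullary using (yes; no; ¬_)
open import Relation.Nullary.Negation using (contradiction)
open import Function using (_$_)
open import Relation.Binary.PropositionalEquality

iter-inflationary : ∀ (f : ℕ → ℕ) → (∀ y → y < f y) → ∀ j y → y ≤ iter j f y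
iter-inflationary f f-infl zero    y = ≤-refl
iter-inflationary f f-infl (suc j) y = ≤-trans (iter-inflationary f f-infl j y) (<⇒≤ (f-infl _))

iter-suc-> : ∀ (f : ℕ → ℕ) → (∀ y → y < f y) → ∀ j y → y < iter (suc j) f y
iter-suc-> f f-infl j y = ≤-<-trans (iter-inflationary f f-infl j y) (f-infl _)

increasing⇒< : ∀ (f : ℕ → ℕ) {n} → (∀ i → i < n → f i < f (suc i)) → ∀ {j} → j < n → f j < f n
increasing⇒< f {suc n} inc {j} (s≤s j≤n) with m≤n⇒m<n∨m≡n j≤n
... | inj₁ j<n  = <-trans (increasing⇒< f (λ i i<n → inc i (m<n⇒m<1+n i<n)) j<n) (inc n ≤-refl)
... | inj₂ refl = inc j ≤-refl

_[_]≔_ : (ℕ → ℕ) → ℕ → ℕ → ℕ → ℕ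
(f [ j ]≔ v) i with i ≟ j
... | yes _ = v
... | no  _ = f i

[]≔-updates : ∀ f j v → (f [ j ]≔ v) j ≡ v
[]≔-updates f j v with j ≟ j
... | yes _   = refl
... | no  j≢j = contradiction refl j≢j

[]≔-minimal : ∀ f j v {i} → ¬ i ≡ j → (f [ j ]≔ v) i ≡ f i
[]≔-minimal f j v {i} i≢j with i ≟ j
... | yes i≡j = contradiction i≡j i≢j
... | no  _   = refl

module Normal-form (k₀ : ℕ) where

  k : ℕ
  k = 2 + k₀

  Aₖ : ℕ → ℕ → ℕ
  Aₖ x = A x k

  A-inflationary : ∀ x y → y < Aₖ x y
  A-<-suc : ∀ x y → Aₖ x y < Aₖ x (suc y)

  A-<-suc zero    y = ^-monoʳ-< k (s≤s (s≤s z≤n)) (n<1+n y)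
  A-<-suc (suc x) y = iter-suc-> (Aₖ x) (A-inflationary x) (suc k₀) (Aₖ (suc x) y)

  A-inflationary zero    zero    = s≤s z≤n
  A-inflationary (suc x) zero    = iter-inflationary (Aₖ x) (A-inflationary x) k 1
  A-inflationary x       (suc y) = ≤-trans (s≤s (A-inflationary x y)) (A-<-suc x y)

  A′-inflationary : ∀ x y → y ≤ A′ x k y
  A′-inflationary x zero    = z≤n
  A′-inflationary x (suc y) = A-inflationary x y

  A-mono-< : ∀ x {y z} → y < z → Aₖ x y < Aₖ x z
  A-mono-< x = increasing⇒< (Aₖ x) (λ i _ → A-<-suc x i)

  A-mono-≤ : ∀ x {y z} → y ≤ z → Aₖ x y ≤ Aₖ x z
  A-mono-≤ x y≤z with m≤n⇒m<n∨m≡n y≤z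
  ... | inj₁ y<z  = <⇒≤ (A-mono-< x y<z)
  ... | inj₂ refl = ≤-refl

  Step : (t α β M M′ : ℕ) → Set
  Step t α β M M′ =
    Aₖ α M ≤ t × t < Aₖ (suc α) M × Aₖ α β ≤ t × t < Aₖ α (suc β) × M′ ≡ Aₖ α β

  Steps : (t p : ℕ) (as bs ms : ℕ → ℕ) → Set
  Steps t p as bs ms = ∀ i → i < p → Step t (as (suc i)) (bs (suc i)) (ms i) (ms (suc i))

  Chain : (t a b : ℕ) → Set
  Chain t a b =
    Σ ℕ λ n → 1 ≤ n × Σ (ℕ → ℕ) λ as → Σ (ℕ → ℕ) λ bs → Σ (ℕ → ℕ) λ ms →
      ms 0 ≡ 0 × Steps t n as bs ms × t < Aₖ 0 (ms n) × a ≡ as n × b ≡ bs n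

  Step⇒≤ : ∀ α {t β M M′} → Step t α β M M′ → M ≤ β
  Step⇒≤ α (AM≤t , _ , _ , t<Aβ+1 , _) =
    ≮⇒≥ (λ β<M → <-irrefl refl (<-≤-trans t<Aβ+1 (≤-trans (A-mono-≤ α β<M) AM≤t)))

  Step⇒< : ∀ α {t β M M′} → Step t α β M M′ → M < M′
  Step⇒< α {M = M} s@(_ , _ , _ , _ , refl) =
    <-≤-trans (A-inflationary α M) (A-mono-≤ α (Step⇒≤ α s))

  Step-pred : ∀ α {t β M M′} → Step (suc t) α β M M′ → M′ ≤ t → Step t α β M M′
  Step-pred α {t} s@(_ , t<AM , _ , t<Aβ+1 , refl) Aβ≤t =
    ≤-trans (A-mono-≤ α (Step⇒≤ α s)) Aβ≤t , <-trans (n<1+n t) t<AM ,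
    Aβ≤t , <-trans (n<1+n t) t<Aβ+1 , refl

  Steps-pred : ∀ {t n as bs ms} → Steps (suc t) (suc n) as bs ms → ms (suc n) ≡ suc t →
    Steps t n as bs ms
  Steps-pred {n = n} {as} {ms = ms} steps last≡ i i<n =
    Step-pred (as (suc i)) (steps i (m<n⇒m<1+n i<n))
      (s≤s⁻¹ (subst (ms (suc i) <_) last≡ ms[i+1]<ms[n+1]))
    where
    ms[i+1]<ms[n+1] : ms (suc i) < ms (suc n)
    ms[i+1]<ms[n+1] =
      increasing⇒< ms (λ j j<n+1 → Step⇒< (as (suc j)) (steps j j<n+1)) (s≤s i<n)

  Steps-snoc : ∀ α β {t p as bs ms} → Steps t p as bs ms → Step t α β (ms p) (Aₖ α β) →
    Steps t (suc p) (as [ suc p ]≔ α) (bs [ suc p ]≔ β) (ms [ suc p ]≔ Aₖ α β)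
  Steps-snoc α β {p = p} {as} {bs} {ms} steps s i (s≤s i≤p) with m≤n⇒m<n∨m≡n i≤p
  ... | inj₁ i<p
    rewrite []≔-minimal as (suc p) α {suc i} (λ e → <-irrefl (suc-injective e) i<p)
          | []≔-minimal bs (suc p) β {suc i} (λ e → <-irrefl (suc-injective e) i<p)
          | []≔-minimal ms (suc p) (Aₖ α β) {suc i} (λ e → <-irrefl (suc-injective e) i<p)
          | []≔-minimal ms (suc p) (Aₖ α β) {i} (λ e → <-irrefl e (m<n⇒m<1+n i<p))
          = steps i i<p
  ... | inj₂ refl
    rewrite []≔-updates as (suc p) α | []≔-updates bs (suc p) β
          | []≔-updates ms (suc p) (Aₖ α β)
          | []≔-minimal ms (suc p) (Aₖ α β) {p} (λ e → 1+n≢n (sym e))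
          = s

  data ChainFrom (t : ℕ) : (M a b : ℕ) → Set where
    last : ∀ {M} α β → Step t α β M (Aₖ α β) → t < Aₖ 0 (Aₖ α β) → ChainFrom t M α β
    step : ∀ {M a b} α β → Step t α β M (Aₖ α β) → ChainFrom t (Aₖ α β) a b → ChainFrom t M a b

  append : ∀ {t} p as bs ms {M a b} → ms 0 ≡ 0 → Steps t p as bs ms → ms p ≡ M →
    ChainFrom t M a b → Chain t a b
  append {t} p as bs ms ms0≡0 steps refl (last α β s t<A0) =
    suc p , s≤s z≤n , as [ suc p ]≔ α , bs [ suc p ]≔ β , ms [ suc p ]≔ Aₖ α β ,
    trans ([]≔-minimal ms (suc p) (Aₖ α β) (λ ())) ms0≡0 ,
    Steps-snoc α β {as = as} {bs} {ms} steps s ,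
    subst (λ M′ → t < Aₖ 0 M′) (sym ([]≔-updates ms (suc p) (Aₖ α β))) t<A0 ,
    sym ([]≔-updates as (suc p) α) , sym ([]≔-updates bs (suc p) β)
  append p as bs ms ms0≡0 steps refl (step α β s rest) =
    append (suc p) (as [ suc p ]≔ α) (bs [ suc p ]≔ β) (ms [ suc p ]≔ Aₖ α β)
      (trans ([]≔-minimal ms (suc p) (Aₖ α β) (λ ())) ms0≡0)
      (Steps-snoc α β {as = as} {bs} {ms} steps s)
      ([]≔-updates ms (suc p) (Aₖ α β)) rest

  step-below : ∀ α {M t w} → M ≤ w → suc t ≡ Aₖ α (suc w) → t < Aₖ (suc α) M →
    Step t α w M (Aₖ α w)
  step-below α {t = t} {w} M≤w t+1≡ t<AM =
    ≤-trans (A-mono-≤ α M≤w) Aw≤t , t<AM , Aw≤t , subst (t <_) t+1≡ (n<1+n t) , refl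
    where
    Aw≤t : Aₖ α w ≤ t
    Aw≤t = s≤s⁻¹ (subst (Aₖ α w <_) (sym t+1≡) (A-<-suc α w))

  below-A-A : ∀ α w {t} → suc t ≡ Aₖ α (suc w) → t < Aₖ α (Aₖ α w)
  below-A-A α w t+1≡ = subst (_≤ Aₖ α (Aₖ α w)) (sym t+1≡) (A-mono-≤ α (A-inflationary α w))

  expand : ℕ → ℕ → ℕ
  expand x c = Aₖ x (iter (k ∸ 1) (Aₖ x) c ∸ 1)

  -- The index b of the level-0 step reached by descending from A_x^k c:
  -- A_0 (bottom x c) is the last term of the left expansion sequence.
  bottom : ℕ → ℕ → ℕ
  bottom zero    c = iter (k ∸ 1) (Aₖ 0) c ∸ 1
  bottom (suc x) c = bottom x (expand (suc x) c)

  descend : ∀ x c {M t} → M < iter (k ∸ 1) (Aₖ x) c → suc t ≡ Aₖ x (iter (k ∸ 1) (Aₖ x) c) →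
    t < Aₖ (suc x) M → ChainFrom t M 0 (bottom x c)
  descend zero c M<z t+1≡ t<AM with iter (k ∸ 1) (Aₖ 0) c
  ... | suc w = last 0 w (step-below 0 (s≤s⁻¹ M<z) t+1≡ t<AM) (below-A-A 0 w t+1≡)
  descend (suc x) c M<z t+1≡ t<AM with iter (k ∸ 1) (Aₖ (suc x)) c
  ... | suc w =
    step (suc x) w (step-below (suc x) (s≤s⁻¹ M<z) t+1≡ t<AM) $
    descend x (Aₖ (suc x) w) (iter-suc-> (Aₖ x) (A-inflationary x) k₀ _)
      t+1≡ (below-A-A (suc x) w t+1≡)

  A-iter≡k*A-bottom : ∀ x c → Aₖ x (iter (k ∸ 1) (Aₖ x) c) ≡ k * Aₖ 0 (bottom x c)
  A-iter≡k*A-bottom zero c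
    with iter (k ∸ 1) (Aₖ 0) c | iter-suc-> (Aₖ 0) (A-inflationary 0) k₀ c
  ... | suc w | _ = refl
  A-iter≡k*A-bottom (suc x) c
    with iter (k ∸ 1) (Aₖ (suc x)) c | iter-suc-> (Aₖ (suc x)) (A-inflationary (suc x)) k₀ c
  ... | suc w | _ = A-iter≡k*A-bottom x (Aₖ (suc x) w)

  A-bottom≡leftSeq : ∀ {a b} x i → a ≡ suc (x + i) →
    Aₖ 0 (bottom x (leftSeq k a b i)) ≡ leftSeq k a b a
  A-bottom≡leftSeq {a} {b} zero i a≡ = begin
    expand 0 (leftSeq k a b i)   ≡⟨ cong (λ y → expand y (leftSeq k a b i)) (sym a∸[i+1]≡0) ⟩
    leftSeq k a b (suc i)        ≡⟨ cong (leftSeq k a b) (sym a≡) ⟩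
    leftSeq k a b a              ∎
    where
    open ≡-Reasoning
    a∸[i+1]≡0 : a ∸ suc i ≡ 0
    a∸[i+1]≡0 = trans (cong (_∸ suc i) a≡) (n∸n≡0 i)
  A-bottom≡leftSeq {a} {b} (suc x) i a≡ = begin
    Aₖ 0 (bottom x (expand (suc x) (leftSeq k a b i)))
      ≡⟨ cong (λ y → Aₖ 0 (bottom x (expand y (leftSeq k a b i)))) (sym a∸[i+1]≡x+1) ⟩
    Aₖ 0 (bottom x (leftSeq k a b (suc i)))
      ≡⟨ A-bottom≡leftSeq x (suc i) (trans a≡ (cong suc (sym (+-suc x i)))) ⟩
    leftSeq k a b a
      ∎
    where
    open ≡-Reasoning
    a∸[i+1]≡x+1 : a ∸ suc i ≡ suc x
    a∸[i+1]≡x+1 = trans (cong (_∸ suc i) a≡) (m+n∸n≡m (suc x) i)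

  descent-below-A : ∀ a′ b {M t} → M ≤ b → suc t ≡ Aₖ (suc a′) b → t < Aₖ (suc (suc a′)) M →
    ChainFrom t M 0 (bottom a′ (A′ (suc a′) k b))
  descent-below-A a′ b M≤b t+1≡ t<AM with m≤n⇒m<n∨m≡n M≤b
  descent-below-A a′ b {t = t} M≤b t+1≡ t<AM | inj₂ refl =
    descend a′ (A′ (suc a′) k b)
      (≤-<-trans (A′-inflationary (suc a′) b) (iter-suc-> (Aₖ a′) (A-inflationary a′) k₀ _))
      t+1≡ (subst (t <_) t+1≡ (n<1+n t))
  descent-below-A a′ (suc b′) M≤b t+1≡ t<AM | inj₁ (s≤s M≤b′) =
    step (suc a′) b′ (step-below (suc a′) M≤b′ t+1≡ t<AM) $
    descend a′ (Aₖ (suc a′) b′) (iter-suc-> (Aₖ a′) (A-inflationary a′) k₀ _)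
      t+1≡ (below-A-A (suc a′) b′ t+1≡)

  simpNF-from-chain : ∀ {t β D} → D ≡ Aₖ 0 β → suc t ≡ k * Aₖ 0 β → Chain t 0 β →
    SimpNF k t D (k ∸ 1) (D ∸ 1)
  simpNF-from-chain {β = β} {zero} D≡ _ _ = contradiction D≡ (<⇒≢ (m^n>0 k β))
  simpNF-from-chain {t} {β} {suc d} D≡ t+1≡ chain =
    0 , β , D≡ ,
    ((suc d * k₀ + d , subst (0 <_) (sym t≡D+r) (s≤s z≤n) ,
      subst (λ D′ → t ≡ D′ + (suc d * k₀ + d)) D≡ t≡D+r , chain) ,
     subst (λ D′ → t ≡ D′ * suc k₀ + d) D≡ t≡D*[k-1]+[D-1] , subst (d <_) D≡ ≤-refl)
    where
    open +-*-Solver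
    t≡d+[k-1]*D : t ≡ d + suc k₀ * suc d
    t≡d+[k-1]*D = suc-injective (trans t+1≡ (cong (k *_) (sym D≡)))
    t≡D*[k-1]+[D-1] : t ≡ suc d * suc k₀ + d
    t≡D*[k-1]+[D-1] = trans t≡d+[k-1]*D
      (solve 2 (λ d k₀ → d :+ (con 1 :+ k₀) :* (con 1 :+ d)
                      := (con 1 :+ d) :* (con 1 :+ k₀) :+ d) refl d k₀)
    t≡D+r : t ≡ suc d + (suc d * k₀ + d)
    t≡D+r = trans t≡d+[k-1]*D
      (solve 2 (λ d k₀ → d :+ (con 1 :+ k₀) :* (con 1 :+ d)
                      := (con 1 :+ d) :+ ((con 1 :+ d) :* k₀ :+ d)) refl d k₀)

lemma4p6 : (k : ℕ) → 2 ≤ k → (m a b : ℕ) → 0 < a → NF k m a b 0 →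
    SimpNF k (m ∸ 1) (leftSeq k a b a) (k ∸ 1) (leftSeq k a b a ∸ 1)
lemma4p6 (suc (suc k₀)) (s≤s (s≤s z≤n)) zero a b _ (() , _)
lemma4p6 (suc (suc k₀)) (s≤s (s≤s z≤n)) (suc t) (suc a′) b _ (_ , _ , zero , () , _)
lemma4p6 (suc (suc k₀)) (s≤s (s≤s z≤n)) (suc t) (suc a′) b _
         (_ , t+1≡A+0 , suc n , _ , as , bs , ms , ms0≡0 , steps , _ , a≡ , b≡) =
  simpNF-from-chain c_a≡A-bottom (trans t+1≡A (A-iter≡k*A-bottom a′ c₀)) chain
  where
  open Normal-form k₀
  c₀ : ℕ
  c₀ = A′ (suc a′) k b
  t+1≡A : suc t ≡ Aₖ (suc a′) b
  t+1≡A = trans t+1≡A+0 (+-identityʳ _)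
  last-step : Step (suc t) (suc a′) b (ms n) (ms (suc n))
  last-step = subst₂ (λ α β → Step (suc t) α β (ms n) (ms (suc n))) (sym a≡) (sym b≡) (steps n ≤-refl)
  ms[n+1]≡t+1 : ms (suc n) ≡ suc t
  ms[n+1]≡t+1 = trans (proj₂ (proj₂ (proj₂ (proj₂ last-step)))) (sym t+1≡A)
  t<A[a+1]ms[n] : t < Aₖ (suc (suc a′)) (ms n)
  t<A[a+1]ms[n] = <-trans (n<1+n t) (proj₁ (proj₂ last-step))
  chain : Chain t 0 (bottom a′ c₀)
  chain = append n as bs ms ms0≡0 (Steps-pred {as = as} {bs} {ms} steps ms[n+1]≡t+1) refl
            (descent-below-A a′ b (Step⇒≤ (suc a′) last-step) t+1≡A t<A[a+1]ms[n])
  c_a≡A-bottom : leftSeq k (suc a′) b (suc a′) ≡ Aₖ 0 (bottom a′ c₀)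
  c_a≡A-bottom = sym (A-bottom≡leftSeq a′ 0 (cong suc (sym (+-identityʳ a′))))
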